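{- Let $G$ be a graph and let $H$ be a $G$-free $k$-critical graph. Then $\delta(H)\geq \delta(G)(k-1)$.
   Context: All graphs are finite and simple. A copy of $G$ in $H$ is a subgraph of $H$ isomorphic to $G$. A $G$-free $k$-coloring of $H$ is a map $\pi:V(H)\to\{1,\dots,k\}$ such that each induced subgraph $H[\pi^{ -1}(i)]$ contains no copy of $G$. $\chi_G(H)$ is the least $k$ for which such a coloring exists. A graph $H$ with $\chi_G(H)=k$ is $G$-free $k$-critical if every proper subgraph $H'$ of $H$ satisfies $\chi_G(H')\leq k-1$. $\delta(\cdot)$ denotes minimum degree. -}

module Defs where

open import Data.Nat using (ℕ; zero; suc; _≤_; _⊓_)
open import Data.Bool using (Bool; true; false)
open import Data.Fin using (Fin)
open import Data.Product using (Σ; ∃; _×_)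
open import Data.List using (List; filter; length)
open import Data.Fin.Base using () renaming (zero to fz; suc to fs)
open import Data.List using (allFin)
open import Relation.Binary.PropositionalEquality using (_≡_)
open import Relation.Nullary using (¬_)
open import Data.Bool.Properties using (T?)
open import Function.Definitions using (Injective; Surjective)

record Graph : Set where
  field
    n      : ℕ
    adj    : Fin n → Fin n → Bool
    sym    : ∀ u v → adj u v ≡ adj v u
    irrefl : ∀ v → adj v v ≡ false
open Graph public

V : Graph → Set
V G = Fin (n G)

deg : (G : Graph) → V G → ℕ
deg G v = length (filter (λ u → T? (adj G v u)) (allFin (n G)))

minFin : ∀ {m} → (Fin (suc m) → ℕ) → ℕ
minFin {zero}  f = f fz
minFin {suc m} f = f fz ⊓ minFin (λ i → f (fs i))

-- minimum degree δ(G); by convention 0 for the graph with no vertices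
δ : Graph → ℕ
δ G with n G | deg G
... | zero  | _ = 0
... | suc m | d = minFin d

-- An embedding of K into H as a (not necessarily induced) subgraph:
-- an injective vertex map sending edges to edges.
-- A copy of G in H is exactly the image of such an embedding G ↪ H,
-- and a subgraph of H is (up to isomorphism) the image of such K ↪ H.
record Embedding (K H : Graph) : Set where
  field
    map      : V K → V H
    injective : Injective _≡_ _≡_ map
    edges    : ∀ u v → adj K u v ≡ true → adj H (map u) (map v) ≡ true
open Embedding public

Spanning-all : ∀ {K H} → Embedding K H → Set
Spanning-all {K} {H} e =
  Surjective _≡_ _≡_ (map e) ×
  (∀ u v → adj H (map e u) (map e v) ≡ true → adj K u v ≡ true)

Proper : ∀ {K H} → Embedding K H → Set
Proper e = ¬ Spanning-all e

-- π : V(H) → Fin k is G-free if no colour class H[π⁻¹(i)] contains a copy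
-- of G, i.e. there is no copy of G all of whose vertices get the same colour.
GFreeColoring : (G H : Graph) (k : ℕ) → (V H → Fin k) → Set
GFreeColoring G H k π =
  (i : Fin k) → (e : Embedding G H) → ¬ (∀ u → π (map e u) ≡ i)

HasGFreeColoring : (G H : Graph) (k : ℕ) → Set
HasGFreeColoring G H k = Σ (V H → Fin k) (GFreeColoring G H k)

ChiIs : (G H : Graph) (k : ℕ) → Set
ChiIs G H k = HasGFreeColoring G H k × (∀ j → HasGFreeColoring G H j → k ≤ j)

ChiLe : (G H : Graph) (j : ℕ) → Set
ChiLe G H j = ∃ λ c → ChiIs G H c × c ≤ j

{-# OPTIONS --safe #-}
-- Take v of minimum degree in H. By criticality H − v has a G-free (k−1)-coloring π.
-- If deg v < δ(G)(k−1), some color i occurs on fewer than δ(G) neighbors of v; give v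
-- that color. A monochromatic copy of G would have to pass through v, and the at least
-- δ(G) neighbors of its preimage of v would all be i-colored neighbors of v. So H is
-- G-free (k−1)-colorable, contradicting χ_G(H) = k.
module Submission where

open import Defs hiding (sym)
open import Data.Nat using (ℕ; zero; suc; _≤_; _<_; _*_; _+_; _∸_; z≤n; s≤s; _≤?_)
open import Data.Nat.Properties
  using (+-0-commutativeMonoid; ≤-refl; ≤-trans; ≤-<-trans; +-monoˡ-≤; +-cancelˡ-<;
         ≰⇒>; n≮n; n≢0⇒n>0; m<n⇒n≢0; *-comm; *-zeroʳ; m⊓n≤m; m⊓n≤n; ⊓-sel; module ≤-Reasoning)
open import Data.Bool using (Bool; true; false; _∧_)
open import Data.Bool.Properties using (T?)
open import Data.Fin using (Fin; punchIn; punchOut; inject≤)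
import Data.Fin.Properties as Fin
open import Data.Fin.Properties
  using (_≟_; any?; punchInᵢ≢i; punchIn-injective; punchIn-punchOut; punchOut-injective; inject≤-injective)
open import Data.Vec.Functional using (insertAt)
open import Data.Vec.Functional.Properties using (insertAt-lookup; insertAt-punchIn)
open import Data.List using (filter; length; tabulate)
open import Data.Product using (Σ; ∃; _,_; proj₁; proj₂)
open import Data.Sum using (inj₁; inj₂)
open import Function using (_∘_)
open import Function.Definitions using (Injective)
open import Relation.Nullary using (does; yes; no; contradiction)
open import Relation.Nullary.Decidable using (dec-true; dec-false)
open import Relation.Binary.PropositionalEquality
  using (_≡_; _≢_; refl; sym; trans; cong; cong₂; subst; subst₂; module ≡-Reasoning)
open import Algebra.Properties.CommutativeMonoid.Sum +-0-commutativeMonoid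
  using (sum; sum-syntax; sum-remove; ∑-comm; sum-cong-≗; sum-replicate-zero)

𝟙 : Bool → ℕ
𝟙 true  = 1
𝟙 false = 0

count : ∀ {n} → (Fin n → Bool) → ℕ
count {n} p = ∑[ i < n ] 𝟙 (p i)

length-filter-tabulate : ∀ {A : Set} n (f : Fin n → A) (p : A → Bool) →
  length (filter (T? ∘ p) (tabulate f)) ≡ count (p ∘ f)
length-filter-tabulate zero    f p = refl
length-filter-tabulate (suc n) f p with p (f Fin.zero)
... | true  = cong suc (length-filter-tabulate n (f ∘ Fin.suc) p)
... | false = length-filter-tabulate n (f ∘ Fin.suc) p

count-punchIn : ∀ {n} (p : Fin (suc n) → Bool) (i : Fin (suc n)) →
  count p ≡ 𝟙 (p i) + count (p ∘ punchIn i)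
count-punchIn p i = sum-remove {i = i} (𝟙 ∘ p)

sum-𝟙-≟ : ∀ {c} (a : Fin c) → ∑[ j < c ] 𝟙 (does (a ≟ j)) ≡ 1
sum-𝟙-≟ {suc c} a = begin
  ∑[ j < suc c ] 𝟙 (does (a ≟ j))                           ≡⟨ sum-remove {i = a} (λ j → 𝟙 (does (a ≟ j))) ⟩
  𝟙 (does (a ≟ a)) + ∑[ j < c ] 𝟙 (does (a ≟ punchIn a j))  ≡⟨ cong₂ _+_ (cong 𝟙 (dec-true (a ≟ a) refl))
                                                                 (sum-cong-≗ (cong 𝟙 ∘ a≢punchIn)) ⟩
  1 + ∑[ j < c ] 0                                          ≡⟨ cong suc (sum-replicate-zero c) ⟩
  1                                                         ∎
  where
  open ≡-Reasoning
  a≢punchIn : ∀ j → does (a ≟ punchIn a j) ≡ false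
  a≢punchIn j = dec-false (a ≟ punchIn a j) (punchInᵢ≢i a j ∘ sym)

count-partition : ∀ {n c} (p : Fin n → Bool) (f : Fin n → Fin c) →
  count p ≡ ∑[ j < c ] count (λ u → p u ∧ does (f u ≟ j))
count-partition {n} {c} p f = begin
  ∑[ u < n ] 𝟙 (p u)                              ≡⟨ sum-cong-≗ (λ u → sym (sum-𝟙-∧ (p u) (f u))) ⟩
  ∑[ u < n ] ∑[ j < c ] 𝟙 (p u ∧ does (f u ≟ j))  ≡⟨ ∑-comm (λ u j → 𝟙 (p u ∧ does (f u ≟ j))) ⟩
  ∑[ j < c ] ∑[ u < n ] 𝟙 (p u ∧ does (f u ≟ j))  ∎
  where
  open ≡-Reasoning
  sum-𝟙-∧ : ∀ b a → ∑[ j < c ] 𝟙 (b ∧ does (a ≟ j)) ≡ 𝟙 b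
  sum-𝟙-∧ false a = sum-replicate-zero c
  sum-𝟙-∧ true  a = sum-𝟙-≟ a

count-≤-injective : ∀ {m n} (p : Fin m → Bool) (q : Fin n → Bool) (f : Fin m → Fin n) →
  Injective _≡_ _≡_ f → (∀ x → p x ≡ true → q (f x) ≡ true) → count p ≤ count q
count-≤-injective {zero} p q f f-inj p⇒q = z≤n
count-≤-injective {suc m} {zero} p q f f-inj p⇒q with () ← f Fin.zero
count-≤-injective {suc m} {suc n} p q f f-inj p⇒q with p Fin.zero in p₀
... | false = count-≤-injective (p ∘ Fin.suc) q (f ∘ Fin.suc) (Fin.suc-injective ∘ f-inj) (p⇒q ∘ Fin.suc)
... | true  = begin
  suc (count (p ∘ Fin.suc))          ≤⟨ s≤s (count-≤-injective (p ∘ Fin.suc) (q ∘ punchIn y₀) g g-inj p⇒q∘g) ⟩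
  suc (count (q ∘ punchIn y₀))       ≡⟨ cong (λ b → 𝟙 b + count (q ∘ punchIn y₀)) (sym (p⇒q Fin.zero p₀)) ⟩
  𝟙 (q y₀) + count (q ∘ punchIn y₀)  ≡⟨ sym (count-punchIn q y₀) ⟩
  count q                            ∎
  where
  open ≤-Reasoning
  y₀ : Fin (suc n)
  y₀ = f Fin.zero
  y₀≢f : ∀ x → y₀ ≢ f (Fin.suc x)
  y₀≢f x eq with () ← f-inj eq
  g : Fin m → Fin n
  g x = punchOut (y₀≢f x)
  g-inj : Injective _≡_ _≡_ g
  g-inj {x} {x′} = Fin.suc-injective ∘ f-inj ∘ punchOut-injective (y₀≢f x) (y₀≢f x′)
  p⇒q∘g : ∀ x → p (Fin.suc x) ≡ true → q (punchIn y₀ (g x)) ≡ true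
  p⇒q∘g x px rewrite punchIn-punchOut (y₀≢f x) = p⇒q (Fin.suc x) px

sum<*⇒∃< : ∀ {c} d (g : Fin c → ℕ) → sum g < c * d → ∃ λ j → g j < d
sum<*⇒∃< {suc c} d g lt with d ≤? g Fin.zero
... | no d≰g₀  = Fin.zero , ≰⇒> d≰g₀
... | yes d≤g₀ with j , gⱼ<d ← sum<*⇒∃< d (g ∘ Fin.suc) (+-cancelˡ-< d _ _ (≤-<-trans (+-monoˡ-≤ _ d≤g₀) lt))
  = Fin.suc j , gⱼ<d

deg≡count : (G : Graph) (v : V G) → deg G v ≡ count (adj G v)
deg≡count G v = length-filter-tabulate (n G) (λ u → u) (adj G v)

minFin-≤ : ∀ {m} (f : Fin (suc m) → ℕ) (i : Fin (suc m)) → minFin f ≤ f i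
minFin-≤ {zero}  f Fin.zero    = ≤-refl
minFin-≤ {suc m} f Fin.zero    = m⊓n≤m _ _
minFin-≤ {suc m} f (Fin.suc i) = ≤-trans (m⊓n≤n _ _) (minFin-≤ (f ∘ Fin.suc) i)

minFin-attained : ∀ {m} (f : Fin (suc m) → ℕ) → ∃ λ i → f i ≡ minFin f
minFin-attained {zero}  f = Fin.zero , refl
minFin-attained {suc m} f with ⊓-sel (f Fin.zero) (minFin (f ∘ Fin.suc))
... | inj₁ min≡f₀ = Fin.zero , sym min≡f₀
... | inj₂ min≡rest with i , fᵢ≡ ← minFin-attained (f ∘ Fin.suc) = Fin.suc i , trans fᵢ≡ (sym min≡rest)

δ≤deg : (G : Graph) (w : V G) → δ G ≤ deg G w
δ≤deg G@record { n = suc m } w = minFin-≤ (deg G) w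

δ-attained : (G : Graph) → V G → ∃ λ v → deg G v ≡ δ G
δ-attained G@record { n = suc m } _ = minFin-attained (deg G)

0<δ⇒vertex : (G : Graph) → 0 < δ G → V G
0<δ⇒vertex record { n = suc m } _ = Fin.zero

-- The vertex of G is needed: an empty G is a monochromatic copy in every color, yet
-- the empty map is a G-free 0-coloring of an empty H.
HasGFreeColoring-mono : ∀ {G H c k} → V G → c ≤ k → HasGFreeColoring G H c → HasGFreeColoring G H k
HasGFreeColoring-mono {G} {H} {c} {k} w₀ c≤k (π , π-free) = (λ x → inject≤ (π x) c≤k) , free
  where
  free : GFreeColoring G H k (λ x → inject≤ (π x) c≤k)
  free i e mono = π-free (π (map e w₀)) e λ w →
    inject≤-injective c≤k c≤k _ _ (trans (mono w) (sym (mono w₀)))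

ChiIs-suc⇒vertex : ∀ {G H k} → ChiIs G H (suc k) → V H
ChiIs-suc⇒vertex {H = record { n = zero }} (_ , minimal) with () ← minimal 0 ((λ ()) , (λ ()))
ChiIs-suc⇒vertex {H = record { n = suc m }} _ = Fin.zero

_─_ : (H : Graph) → V H → Graph
record { n = suc m ; adj = A ; sym = S ; irrefl = I } ─ v = record
  { n      = m
  ; adj    = λ a b → A (punchIn v a) (punchIn v b)
  ; sym    = λ a b → S (punchIn v a) (punchIn v b)
  ; irrefl = λ a → I (punchIn v a)
  }

─-embedding : (H : Graph) (v : V H) → Embedding (H ─ v) H
─-embedding record { n = suc m } v = record
  { map       = punchIn v
  ; injective = punchIn-injective v _ _
  ; edges     = λ a b ab → ab
  }

─-proper : (H : Graph) (v : V H) → Proper (─-embedding H v)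
─-proper record { n = suc m } v (surjective , _) with x , x↦v ← surjective v = punchInᵢ≢i v x (x↦v refl)

─-lift : ∀ {G} (H : Graph) (v : V H) (e : Embedding G H) → (∀ w → v ≢ map e w) →
  Σ (Embedding G (H ─ v)) λ e′ → ∀ w → map (─-embedding H v) (map e′ w) ≡ map e w
─-lift {G} H@record { n = suc m } v e avoids = e′ , λ w → punchIn-punchOut (avoids w)
  where
  e′ : Embedding G (H ─ v)
  e′ = record
    { map       = λ w → punchOut (avoids w)
    ; injective = λ {x} {y} → injective e ∘ punchOut-injective (avoids x) (avoids y)
    ; edges     = λ x y xy → subst₂ (λ a b → adj H a b ≡ true)
                    (sym (punchIn-punchOut (avoids x))) (sym (punchIn-punchOut (avoids y))) (edges e x y xy)
    }

coloredNeighbors : ∀ {k} (H : Graph) (v : V H) → (V (H ─ v) → Fin k) → Fin k → ℕ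
coloredNeighbors H v π j = count (λ u → adj H v (map (─-embedding H v) u) ∧ does (π u ≟ j))

deg≡∑coloredNeighbors : ∀ {k} (H : Graph) (v : V H) (π : V (H ─ v) → Fin k) →
  deg H v ≡ ∑[ j < k ] coloredNeighbors H v π j
deg≡∑coloredNeighbors {k} H@record { n = suc m } v π = begin
  deg H v                                           ≡⟨ deg≡count H v ⟩
  count (adj H v)                                   ≡⟨ count-punchIn (adj H v) v ⟩
  𝟙 (adj H v v) + count (adj H v ∘ punchIn v)       ≡⟨ cong (λ b → 𝟙 b + count (adj H v ∘ punchIn v)) (irrefl H v) ⟩
  count (adj H v ∘ punchIn v)                       ≡⟨ count-partition (adj H v ∘ punchIn v) π ⟩
  ∑[ j < k ] coloredNeighbors H v π j               ∎
  where open ≡-Reasoning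

rareColor : ∀ {k} (G H : Graph) (v : V H) (π : V (H ─ v) → Fin k) →
  deg H v < δ G * k → ∃ λ i → coloredNeighbors H v π i < δ G
rareColor {k} G H v π deg<δG*k = sum<*⇒∃< (δ G) (coloredNeighbors H v π) (begin-strict
  sum (coloredNeighbors H v π)  ≡⟨ deg≡∑coloredNeighbors H v π ⟨
  deg H v                       <⟨ deg<δG*k ⟩
  δ G * k                       ≡⟨ *-comm (δ G) k ⟩
  k * δ G                       ∎)
  where open ≤-Reasoning

extendColoring : ∀ {A : Set} (H : Graph) (v : V H) → (V (H ─ v) → A) → A → V H → A
extendColoring record { n = suc m } v π i = insertAt π v i

extendColoring-self : ∀ {A : Set} (H : Graph) (v : V H) (π : V (H ─ v) → A) (i : A) →
  extendColoring H v π i v ≡ i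
extendColoring-self record { n = suc m } v π i = insertAt-lookup π v i

extendColoring-─ : ∀ {A : Set} (H : Graph) (v : V H) (π : V (H ─ v) → A) (i : A) (u : V (H ─ v)) →
  extendColoring H v π i (map (─-embedding H v) u) ≡ π u
extendColoring-─ record { n = suc m } v π i u = insertAt-punchIn π v i u

count-extendColoring : ∀ {k} (H : Graph) (v : V H) (π : V (H ─ v) → Fin k) (i j : Fin k) →
  count (λ x → adj H v x ∧ does (extendColoring H v π i x ≟ j)) ≡ coloredNeighbors H v π j
count-extendColoring H@record { n = suc m } v π i j = begin
  count colored                                ≡⟨ count-punchIn colored v ⟩
  𝟙 (colored v) + count (colored ∘ punchIn v)  ≡⟨ cong (λ b → 𝟙 b + count (colored ∘ punchIn v)) v-uncolored ⟩
  count (colored ∘ punchIn v)                  ≡⟨ sum-cong-≗ (cong 𝟙 ∘ colored-punchIn) ⟩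
  coloredNeighbors H v π j                     ∎
  where
  open ≡-Reasoning
  colored : V H → Bool
  colored x = adj H v x ∧ does (insertAt π v i x ≟ j)

  v-uncolored : colored v ≡ false
  v-uncolored rewrite irrefl H v = refl

  colored-punchIn : ∀ u → colored (punchIn v u) ≡ adj H v (punchIn v u) ∧ does (π u ≟ j)
  colored-punchIn u rewrite insertAt-punchIn π v i u = refl

extendColoring-GFree : ∀ {k} (G H : Graph) (v : V H) (π : V (H ─ v) → Fin k) → GFreeColoring G (H ─ v) k π →
  (i : Fin k) → coloredNeighbors H v π i < δ G → GFreeColoring G H k (extendColoring H v π i)
extendColoring-GFree {k} G H v π π-free i rare j e mono with any? (λ w → v ≟ map e w)
... | no avoids with e′ , e′-lifts ← ─-lift H v e (λ w v≡ → avoids (w , v≡)) = π-free j e′ λ w → begin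
  π (map e′ w)                                  ≡⟨ extendColoring-─ H v π i (map e′ w) ⟨
  col (map (─-embedding H v) (map e′ w))        ≡⟨ cong col (e′-lifts w) ⟩
  col (map e w)                                 ≡⟨ mono w ⟩
  j                                             ∎
  where
  open ≡-Reasoning
  col : V H → Fin k
  col = extendColoring H v π i
... | yes (w , v≡ew) = n≮n (δ G) (begin-strict
  δ G                        ≤⟨ δ≤deg G w ⟩
  deg G w                    ≡⟨ deg≡count G w ⟩
  count (adj G w)            ≤⟨ count-≤-injective (adj G w) i-neighbor (map e) (injective e) neighbor-image ⟩
  count i-neighbor           ≡⟨ count-extendColoring H v π i i ⟩
  coloredNeighbors H v π i   <⟨ rare ⟩
  δ G                        ∎)
  where
  open ≤-Reasoning
  col : V H → Fin k
  col = extendColoring H v π i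

  i-neighbor : V H → Bool
  i-neighbor x = adj H v x ∧ does (col x ≟ i)

  i≡j : i ≡ j
  i≡j = trans (sym (extendColoring-self H v π i)) (trans (cong col v≡ew) (mono w))

  neighbor-image : ∀ w′ → adj G w w′ ≡ true → i-neighbor (map e w′) ≡ true
  neighbor-image w′ ww′ = cong₂ _∧_
    (subst (λ x → adj H x (map e w′) ≡ true) (sym v≡ew) (edges e w w′ ww′))
    (dec-true (col (map e w′) ≟ i) (trans (mono w′) (sym i≡j)))

lemma1 : (G H : Graph) (k : ℕ) →
    ChiIs G H k →
    ((K : Graph) (e : Embedding K H) → Proper e → ChiLe G K (k ∸ 1)) →
    δ G * (k ∸ 1) ≤ δ H
lemma1 G H zero _ _ rewrite *-zeroʳ (δ G) = z≤n
lemma1 G H (suc k) χ critical with δ G * k ≤? δ H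
... | yes bound = bound
... | no ¬bound = contradiction (proj₂ χ k H-colorable) (n≮n k)
  where
  δH<δG*k : δ H < δ G * k
  δH<δG*k = ≰⇒> ¬bound

  w₀ : V G
  w₀ = 0<δ⇒vertex G (n≢0⇒n>0 (λ δG≡0 → m<n⇒n≢0 δH<δG*k (cong (_* k) δG≡0)))

  minimum-vertex : ∃ λ v → deg H v ≡ δ H
  minimum-vertex = δ-attained H (ChiIs-suc⇒vertex χ)

  v : V H
  v = proj₁ minimum-vertex

  K-colorable : HasGFreeColoring G (H ─ v) k
  K-colorable with c , (c-coloring , _) , c≤k ← critical (H ─ v) (─-embedding H v) (─-proper H v) =
    HasGFreeColoring-mono w₀ c≤k c-coloring

  H-colorable : HasGFreeColoring G H k
  H-colorable with π , π-free ← K-colorable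
              with i , rare ← rareColor G H v π (subst (_< δ G * k) (sym (proj₂ minimum-vertex)) δH<δG*k) =
    extendColoring H v π i , extendColoring-GFree G H v π π-free i rare
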